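{- Let $\Phi$ be a tight derivation in system $\mathcal{N}$ of $\Gamma\vdash^{(m,e,s)} t:\sigma$. Then $m=e=0$ if and only if $t\in\mathsf{no}_n$.
   Context: Terms are $t,u,r ::= x \mid \lambda x.t \mid t\,u \mid t[x\backslash u]$ over a countably infinite set of variables, where $t[x\backslash u]$ (explicit substitution) binds $x$ in $t$; terms are taken modulo $\alpha$-conversion. CBN neutral and normal terms: $\mathsf{ne}_n ::= x \mid \mathsf{ne}_n\, t$ and $\mathsf{no}_n ::= \lambda x.\mathsf{no}_n \mid \mathsf{ne}_n$. Types. Tight types: $\mathtt{tt} ::= \mathtt{n} \mid \mathtt{a}$. Types: $\sigma,\tau ::= \mathtt{tt} \mid \mathcal{M} \mid \mathcal{M}\to\sigma$, where multitypes $\mathcal{M} = [\sigma_i]_{i\in I}$ are finite multisets of types ($[\,]$ empty, $\sqcup$ union). A typing context $\Gamma$ maps variables to multitypes, $[\,]$ for all but finitely many; $\mathrm{dom}(\Gamma)=\{x \mid \Gamma(x)\neq[\,]\}$; $(\Gamma+\Delta)(x) = \Gamma(x)\sqcup\Delta(x)$, extended to finite sums $+_{i\in I}\Gamma_i$; $\Gamma\setminus\!\!\setminus x$ maps $x$ to $[\,]$ and agrees with $\Gamma$ elsewhere; $\Gamma; x:\mathcal{M}$ maps $x$ to $\mathcal{M}$ and agrees with $\Gamma$ elsewhere, where $x\notin\mathrm{dom}(\Gamma)$. Judgements $\Gamma \vdash^{(m,e,s)} t:\sigma$ carry natural-number counters. System $\mathcal{N}$ consists of the rules: (app$_p$) from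 $\Gamma\vdash^{(m,e,s)} t:\mathtt{n}$ infer $\Gamma\vdash^{(m,e,s+1)} t\,u:\mathtt{n}$; (abs$_p$) from $\Gamma\vdash^{(m,e,s)} t:\mathtt{tt}$ (a tight type) with $\Gamma(x)$ tight, infer $\Gamma\setminus\!\!\setminus x\vdash^{(m,e,s+1)}\lambda x.t:\mathtt{a}$; (var$_c$) $x:[\sigma]\vdash^{(0,0,0)} x:\sigma$; (abs$_c$) from $\Gamma\vdash^{(m,e,s)} t:\tau$ infer $\Gamma\setminus\!\!\setminus x\vdash^{(m,e,s)}\lambda x.t:\Gamma(x)\to\tau$; (app$_c$) from $\Gamma\vdash^{(m,e,s)} t:[\sigma_i]_{i\in I}\to\tau$ and $\Delta_i\vdash^{(m_i,e_i,s_i)} u:\sigma_i$ for each $i\in I$, infer $\Gamma+_{i\in I}\Delta_i\vdash^{(1+m+\sum_i m_i,\,1+e+\sum_i e_i,\,s+\sum_i s_i)} t\,u:\tau$; (es$_c$) from $\Gamma;x:[\sigma_i]_{i\in I}\vdash^{(m,e,s)} t:\tau$ and $\Delta_i\vdash^{(m_i,e_i,s_i)} u:\sigma_i$ for each $i\in I$, infer $(\Gamma\setminus\!\!\setminus x)+_{i\in I}\Delta_i\vdash^{(m+\sum_i m_i,\,1+e+\sum_i e_i,\,s+\sum_i s_i)} t[x\backslash u]:\tau$. A multitype is tight if all its elements are tight types; a context is tight if all multitypes it assigns are tight; a derivation of $\Gamma\vdash^{(m,e,s)} t:\sigma$ is tight if $\Gamma$ is tight and $\sigma$ is a tight type. 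-}

module Defs where

open import Data.Nat using (ℕ; zero; suc; _+_)
open import Data.Fin using (Fin; _≟_)
open import Data.List using (List; []; _∷_; [_]; _++_)
import Data.List.Relation.Unary.All as LAll
open import Data.Vec using (Vec; tabulate; zipWith; replicate; _∷_)
import Data.Vec.Relation.Unary.All as VAll
open import Relation.Nullary using (yes; no)

-- Terms, with de Bruijn indices (so terms are taken modulo α).
-- Tm n : terms with free variables among Fin n.
--   lam t    : λx.t         (t ∈ Tm (suc n), index 0 = x)
--   es t u   : t[x\u]       (t ∈ Tm (suc n), index 0 = x bound by the ES)

data Tm (n : ℕ) : Set where
  var : Fin n → Tm n
  lam : Tm (suc n) → Tm n
  app : Tm n → Tm n → Tm n
  es  : Tm (suc n) → Tm n → Tm n

data Ne {n : ℕ} : Tm n → Set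
data No {n : ℕ} : Tm n → Set

data Ne {n} where
  ne-var : (x : Fin n) → Ne (var x)
  ne-app : {t : Tm n} → Ne t → (u : Tm n) → Ne (app t u)

data No {n} where
  no-lam : {t : Tm (suc n)} → No t → No (lam t)
  no-ne  : {t : Tm n} → Ne t → No t

-- Multitypes (finite multisets) are represented by lists, and the
-- typing rules compare independently derived types only up to the
-- multiset equivalence _≈ᵗ_ below (lists equal up to permutation,
-- recursively).

data Ty : Set where
  tn  : Ty
  ta  : Ty
  mt  : List Ty → Ty
  _⇒_ : List Ty → Ty → Ty

infixr 5 _⇒_

MTy : Set
MTy = List Ty

data IsTight : Ty → Set where
  tight-n : IsTight tn
  tight-a : IsTight ta

TightM : MTy → Set
TightM M = LAll.All IsTight M

data _≈ᵗ_ : Ty → Ty → Set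
data _≋_ : MTy → MTy → Set

data _≈ᵗ_ where
  ≈n  : tn ≈ᵗ tn
  ≈a  : ta ≈ᵗ ta
  ≈mt : {M N : MTy} → M ≋ N → mt M ≈ᵗ mt N
  ≈⇒  : {M N : MTy} {σ τ : Ty} → M ≋ N → σ ≈ᵗ τ → (M ⇒ σ) ≈ᵗ (N ⇒ τ)

data _≋_ where
  ≋[]    : [] ≋ []
  ≋∷     : {σ τ : Ty} {M N : MTy} → σ ≈ᵗ τ → M ≋ N → (σ ∷ M) ≋ (τ ∷ N)
  ≋swap  : {σ τ : Ty} {M : MTy} → (σ ∷ τ ∷ M) ≋ (τ ∷ σ ∷ M)
  ≋trans : {L M N : MTy} → L ≋ M → M ≋ N → L ≋ N

Ctx : ℕ → Set
Ctx n = Vec MTy n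

∅ : {n : ℕ} → Ctx n
∅ = replicate _ []

_+ᶜ_ : {n : ℕ} → Ctx n → Ctx n → Ctx n
Γ +ᶜ Δ = zipWith _++_ Γ Δ

single : {n : ℕ} → Fin n → Ty → Ctx n
single x σ = tabulate (λ y → f y)
  where
    f : _ → MTy
    f y with y ≟ x
    ... | yes _ = [ σ ]
    ... | no  _ = []

TightCtx : {n : ℕ} → Ctx n → Set
TightCtx Γ = VAll.All TightM Γ

-- System N.  Γ ⊢ t ∶ σ ⟨ m , e , s ⟩
-- For binders, the premise context is M ∷ Γ (M = Γ(x)); the conclusion
-- context Γ is then Γ \\ x.

infix 3 _⊢_∶_⟨_,_,_⟩

data _⊢_∶_⟨_,_,_⟩ {n : ℕ} : Ctx n → Tm n → Ty → ℕ → ℕ → ℕ → Set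

-- Args Δ u M m e s : one derivation Δᵢ ⊢ u : σᵢ' with σᵢ' ≈ σᵢ for each
-- element σᵢ of M, with Δ = +ᵢ Δᵢ and the counters summed.
data Args {n : ℕ} : Ctx n → Tm n → MTy → ℕ → ℕ → ℕ → Set

data _⊢_∶_⟨_,_,_⟩ {n} where
  app-p : {Γ : Ctx n} {t : Tm n} {m e s : ℕ} (u : Tm n) →
          Γ ⊢ t ∶ tn ⟨ m , e , s ⟩ →
          Γ ⊢ app t u ∶ tn ⟨ m , e , suc s ⟩
  abs-p : {M : MTy} {Γ : Ctx n} {t : Tm (suc n)} {τ : Ty} {m e s : ℕ} →
          IsTight τ → TightM M →
          (M ∷ Γ) ⊢ t ∶ τ ⟨ m , e , s ⟩ →
          Γ ⊢ lam t ∶ ta ⟨ m , e , suc s ⟩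
  var-c : (x : Fin n) (σ : Ty) →
          single x σ ⊢ var x ∶ σ ⟨ 0 , 0 , 0 ⟩
  abs-c : {M : MTy} {Γ : Ctx n} {t : Tm (suc n)} {τ : Ty} {m e s : ℕ} →
          (M ∷ Γ) ⊢ t ∶ τ ⟨ m , e , s ⟩ →
          Γ ⊢ lam t ∶ (M ⇒ τ) ⟨ m , e , s ⟩
  app-c : {Γ Δ : Ctx n} {t u : Tm n} {M : MTy} {τ : Ty}
          {m e s m' e' s' : ℕ} →
          Γ ⊢ t ∶ (M ⇒ τ) ⟨ m , e , s ⟩ →
          Args Δ u M m' e' s' →
          (Γ +ᶜ Δ) ⊢ app t u ∶ τ ⟨ suc (m + m') , suc (e + e') , s + s' ⟩
  es-c  : {M : MTy} {Γ Δ : Ctx n} {t : Tm (suc n)} {u : Tm n} {τ : Ty}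
          {m e s m' e' s' : ℕ} →
          (M ∷ Γ) ⊢ t ∶ τ ⟨ m , e , s ⟩ →
          Args Δ u M m' e' s' →
          (Γ +ᶜ Δ) ⊢ es t u ∶ τ ⟨ m + m' , suc (e + e') , s + s' ⟩

data Args {n} where
  args-[] : {u : Tm n} → Args ∅ u [] 0 0 0
  args-∷  : {Δ Δs : Ctx n} {u : Tm n} {σ σ' : Ty} {M : MTy}
            {m e s ms es ss : ℕ} →
            Δ ⊢ u ∶ σ' ⟨ m , e , s ⟩ → σ' ≈ᵗ σ →
            Args Δs u M ms es ss →
            Args (Δ +ᶜ Δs) u (σ ∷ M) (m + ms) (e + es) (s + ss)

{-# OPTIONS --safe #-}
module Submission where

-- In a tight derivation, the rules that count multiplicative and exponential
-- steps (app-c, es-c) never type a normal form: a neutral term typed in a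
-- tight context has tight type, so its head can never receive an arrow type,
-- and under a λ the persistent rule abs-p keeps everything tight.  Conversely
-- a derivation using neither app-c nor es-c is built from var-c, app-p and
-- abs-p only, which type exactly the normal forms.

open import Defs
open import Data.Nat using (ℕ)
open import Data.Fin using (Fin; _≟_)
open import Data.Product using (_×_; _,_; proj₂)
open import Data.Vec using ([]; _∷_)
import Data.List.Relation.Unary.All as LAll
import Data.List.Relation.Unary.All.Properties as LAll
import Data.Vec.Relation.Unary.All as VAll
import Data.Vec.Relation.Unary.All.Properties as VAll
open import Relation.Binary.PropositionalEquality using (_≡_; refl)
open import Relation.Nullary using (yes; no; contradiction)
open import Function.Bundles using (_⇔_; mk⇔)

private
  variable
    n m e s : ℕ
    Γ : Ctx n
    t : Tm n
    σ : Ty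

e≡0∧tn⇒Ne : Γ ⊢ t ∶ tn ⟨ m , 0 , s ⟩ → Ne t
e≡0∧tn⇒Ne (var-c x .tn) = ne-var x
e≡0∧tn⇒Ne (app-p u d)   = ne-app (e≡0∧tn⇒Ne d) u

e≡0∧tight⇒No : Γ ⊢ t ∶ σ ⟨ m , 0 , s ⟩ → IsTight σ → No t
e≡0∧tight⇒No (var-c x σ)     _ = no-ne (ne-var x)
e≡0∧tight⇒No (app-p u d)     _ = no-ne (e≡0∧tn⇒Ne (app-p u d))
e≡0∧tight⇒No (abs-p tτ _ d)  _ = no-lam (e≡0∧tight⇒No d tτ)
e≡0∧tight⇒No (abs-c d)      ()

TightCtx-single⁻ : (x : Fin n) → TightCtx (single x σ) → IsTight σ
TightCtx-single⁻ x tΓ with x ≟ x | VAll.tabulate⁻ tΓ x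
... | yes _  | tσ LAll.∷ _ = tσ
... | no x≢x | _           = contradiction refl x≢x

TightCtx-+ᶜ⁻ˡ : (Γ Δ : Ctx n) → TightCtx (Γ +ᶜ Δ) → TightCtx Γ
TightCtx-+ᶜ⁻ˡ []      []      VAll.[]          = VAll.[]
TightCtx-+ᶜ⁻ˡ (M ∷ Γ) (_ ∷ Δ) (tM VAll.∷ tΓΔ) =
  LAll.++⁻ˡ M tM VAll.∷ TightCtx-+ᶜ⁻ˡ Γ Δ tΓΔ

Ne∧tightCtx⇒tight∧m≡e≡0 : Γ ⊢ t ∶ σ ⟨ m , e , s ⟩ → TightCtx Γ → Ne t →
                            IsTight σ × m ≡ 0 × e ≡ 0
Ne∧tightCtx⇒tight∧m≡e≡0 (var-c x σ) tΓ _ = TightCtx-single⁻ x tΓ , refl , refl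
Ne∧tightCtx⇒tight∧m≡e≡0 (app-p u d) tΓ (ne-app nt .u)
  with Ne∧tightCtx⇒tight∧m≡e≡0 d tΓ nt
... | _ , refl , refl = tight-n , refl , refl
Ne∧tightCtx⇒tight∧m≡e≡0 (app-c {Γ = Γ} {Δ = Δ} d _) tΓΔ (ne-app nt _)
  with Ne∧tightCtx⇒tight∧m≡e≡0 d (TightCtx-+ᶜ⁻ˡ Γ Δ tΓΔ) nt
... | () , _

No∧tight⇒m≡e≡0 : Γ ⊢ t ∶ σ ⟨ m , e , s ⟩ → TightCtx Γ → IsTight σ → No t →
                  m ≡ 0 × e ≡ 0
No∧tight⇒m≡e≡0 d tΓ _ (no-ne nt) = proj₂ (Ne∧tightCtx⇒tight∧m≡e≡0 d tΓ nt)
No∧tight⇒m≡e≡0 (abs-p tτ tM d) tΓ _ (no-lam nt) =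
  No∧tight⇒m≡e≡0 d (tM VAll.∷ tΓ) tτ nt
No∧tight⇒m≡e≡0 (abs-c d) _ () (no-lam _)

lemma3p2 : {n : ℕ} {Γ : Ctx n} {t : Tm n} {σ : Ty} {m e s : ℕ} →
    Γ ⊢ t ∶ σ ⟨ m , e , s ⟩ → TightCtx Γ → IsTight σ →
    ((m ≡ 0 × e ≡ 0) ⇔ No t)
lemma3p2 d tΓ tσ =
  mk⇔ (λ { (_ , refl) → e≡0∧tight⇒No d tσ }) (No∧tight⇒m≡e≡0 d tΓ tσ)
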